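{- Let $s\ge 2$ and $p\ge 2$ be fixed integers. The number of pairwise non-isomorphic graphs in $\mathcal{G}(s,p)$ is $\frac{a(p)(a(p)+1)}{2}$, where $a(p)$ is the number of partitions of the integer $p$.
   Context: All graphs are finite, simple and connected. A vertex is simplicial if its neighbourhood is a clique. A minimal vertex separator is a set $S$ that, for some non-adjacent vertices $u,v$, separates $u$ and $v$ into different components of $G-S$ and is inclusion-minimal with this property. A graph is strictly chordal if it is obtained from a block graph (connected graph all of whose blocks are cliques) by adding zero or more true twins ($N[u]=N[v]$) to each vertex; a strictly interval graph is a graph that is both strictly chordal and an interval graph. For integers $s,p\ge 2$, $\mathcal{G}(s,p)$ is the set of $SI$-core graphs with parameters $s,p$: strictly interval graphs $G$ with exactly two minimal vertex separators $S_1,S_2$, such that $|S_1|=|S_2|=s$, $S_1\cup S_2$ is a maximal clique of $G$ (of size $2s$), and each $S_i$ has exactly $p$ simplicial vertices adjacent to it. Explicitly, $V(G)=S_1\cup S_2\cup P_1\cup P_2$ (disjoint), $|P_i|=p$, $P_i$ being the simplicial vertices adjacent to $S_i$; every vertex of $P_i$ is adjacent to all of $S_i$ and to no vertex of $S_{3-i}\cup P_{3-i}$, and $G[P_i]$ is a disjoint union of complete graphs. -}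

module Defs where

open import Data.Nat using (ℕ; _≤_; _≥_; _+_; _*_; _/_)
open import Data.Bool using (Bool; true; false)
open import Data.Fin using (Fin)
open import Data.List using (List; length; filter)
open import Data.Nat.ListAction using (sum)
open import Data.List.Base using (allFin)
open import Data.List.Relation.Unary.All using (All)
open import Data.List.Relation.Unary.Linked using (Linked)
open import Data.Product using (Σ; ∃; _×_)
open import Data.Sum using (_⊎_)
open import Function.Bundles using (_↔_; Inverse; _⇔_)
open import Relation.Binary.PropositionalEquality using (_≡_; _≢_; refl)
open import Relation.Nullary using (yes; no)
open import Relation.Binary.Definitions using (DecidableEquality)

record Graph (n : ℕ) : Set where
  field
    adj    : Fin n → Fin n → Bool
    symm   : ∀ u v → adj u v ≡ adj v u
    irrefl : ∀ v → adj v v ≡ false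

open Graph public

AGraph : Set
AGraph = Σ ℕ Graph

Iso : AGraph → AGraph → Set
Iso (n Data.Product., G) (m Data.Product., H) =
  Σ (Fin n ↔ Fin m) λ f →
    ∀ u v → adj G u v ≡ adj H (Inverse.to f u) (Inverse.to f v)

data Part : Set where
  S₁ S₂ P₁ P₂ : Part

_≟P_ : DecidableEquality Part
S₁ ≟P S₁ = yes refl
S₁ ≟P S₂ = no λ ()
S₁ ≟P P₁ = no λ ()
S₁ ≟P P₂ = no λ ()
S₂ ≟P S₁ = no λ ()
S₂ ≟P S₂ = yes refl
S₂ ≟P P₁ = no λ ()
S₂ ≟P P₂ = no λ ()
P₁ ≟P S₁ = no λ ()
P₁ ≟P S₂ = no λ ()
P₁ ≟P P₁ = yes refl
P₁ ≟P P₂ = no λ ()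
P₂ ≟P S₁ = no λ ()
P₂ ≟P S₂ = no λ ()
P₂ ≟P P₁ = no λ ()
P₂ ≟P P₂ = yes refl

blockSize : ∀ {n} → (Fin n → Part) → Part → ℕ
blockSize {n} part X = length (filter (λ v → part v ≟P X) (allFin n))

otherS : Part → Part
otherS P₁ = S₂
otherS P₂ = S₁
otherS S₁ = S₂
otherS S₂ = S₁

ownS : Part → Part
ownS P₁ = S₁
ownS P₂ = S₂
ownS S₁ = S₁
ownS S₂ = S₂

otherP : Part → Part
otherP P₁ = P₂
otherP P₂ = P₁
otherP S₁ = P₂
otherP S₂ = P₁

IsS : Part → Set
IsS X = X ≡ S₁ ⊎ X ≡ S₂

IsP : Part → Set
IsP X = X ≡ P₁ ⊎ X ≡ P₂

-- SI-core graphs with parameters s, p (the explicit description):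
-- V(G) = S₁ ⊎ S₂ ⊎ P₁ ⊎ P₂ with |S_i| = s, |P_i| = p, S₁ ∪ S₂ a clique,
-- every vertex of P_i adjacent to all of S_i and to nothing in
-- S_{3-i} ∪ P_{3-i}, and G[P_i] a disjoint union of complete graphs
-- (vertices of P_i are adjacent iff they lie in the same component,
-- the components being given by a labelling `comp`).

record SICore (s p : ℕ) (G' : AGraph) : Set where
  n = Data.Product.proj₁ G'
  G = Data.Product.proj₂ G'
  field
    part     : Fin n → Part
    sizeS₁   : blockSize part S₁ ≡ s
    sizeS₂   : blockSize part S₂ ≡ s
    sizeP₁   : blockSize part P₁ ≡ p
    sizeP₂   : blockSize part P₂ ≡ p
    clique   : ∀ u v → u ≢ v → IsS (part u) → IsS (part v) → adj G u v ≡ true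
    toOwnS   : ∀ u v → IsP (part u) → part v ≡ ownS (part u) → adj G u v ≡ true
    noOtherS : ∀ u v → IsP (part u) → part v ≡ otherS (part u) → adj G u v ≡ false
    noOtherP : ∀ u v → IsP (part u) → part v ≡ otherP (part u) → adj G u v ≡ false
    comp     : Fin n → ℕ
    cluster  : ∀ u v → u ≢ v → IsP (part u) → part v ≡ part u →
               (adj G u v ≡ true ⇔ comp u ≡ comp v)

IsPartition : ℕ → List ℕ → Set
IsPartition p λs = All (1 ≤_) λs × Linked _≥_ λs × sum λs ≡ p

{-# OPTIONS --safe #-}
module Submission where

-- An SI-core graph is determined up to isomorphism by the clique sizes of G[P₁] and G[P₂], two
-- partitions of p. Conversely an isomorphism can only keep or exchange the two sides: as s, p ≥ 1
-- the simplicial vertices are exactly those of P₁ ∪ P₂, two of them lie in the same Pᵢ iff they have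
-- a common neighbour, and inside Pᵢ adjacency is the clique relation. A partition is recovered from
-- its clique relation by counting, for each k, the vertices lying in cliques of size k. Hence the
-- isomorphism classes correspond to the unordered pairs of partitions of p.

open import Defs
open import Level using (0ℓ)
open import Axiom.UniquenessOfIdentityProofs using (module Decidable⇒UIP)
open import Data.Bool using (Bool; true; false)
open import Data.Bool.Properties using (T-irrelevant)
open import Data.Fin using (Fin; zero; suc; _↑ˡ_; _↑ʳ_; join; splitAt; fromℕ<) renaming (_≟_ to _≟F_)
open import Data.Fin.Properties using (cantor-schröder-bernstein; injective⇒≤; +↔⊎; splitAt-↑ˡ; splitAt-↑ʳ; nonZeroIndex)
open import Data.List using (List; []; _∷_; _++_; map; length; filter; tabulate; allFin; head)
open import Data.List.Properties
  using (length-map; length-++; length-filter; length-tabulate; filter-all; filter-none; filter-accept; filter-reject; filter-++)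
open import Data.List.Membership.Propositional using (_∈_; lose)
open import Data.List.Membership.Propositional.Properties using (∈-map⁺; ∈-++⁺ˡ; ∈-++⁺ʳ)
open import Data.List.Relation.Unary.All using (All; []; _∷_)
import Data.List.Relation.Unary.All as All
import Data.List.Relation.Unary.All.Properties as All
open import Data.List.Relation.Unary.AllPairs using (AllPairs; []; _∷_)
import Data.List.Relation.Unary.AllPairs as AllPairs
import Data.List.Relation.Unary.AllPairs.Properties as AllPairs
open import Data.List.Relation.Unary.Any using (Any; here; there)
import Data.List.Relation.Unary.Any.Properties as Any
open import Data.List.Relation.Unary.Linked using (Linked; []; _∷′_)
import Data.List.Relation.Unary.Linked as Linked
open import Data.List.Relation.Unary.Linked.Properties using (Linked⇒All)
open import Data.List.Relation.Unary.Unique.Propositional using (Unique)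
open import Data.Maybe using (just)
open import Data.Maybe.Relation.Binary.Connected using (Connected; just; just-nothing)
open import Data.Nat using (ℕ; zero; suc; _+_; _*_; _/_; _≤_; _<_; _≥_; _≟_; >-nonZero⁻¹)
open import Data.Nat.DivMod using (m*n/n≡m)
open import Data.Nat.Induction using (<-wellFounded)
open import Data.Nat.ListAction using (sum)
open import Data.Nat.ListAction.Properties using (sum-++)
open import Data.Nat.Properties
  using (≡-irrelevant; ≤-refl; ≤-trans; ≤-total; ≤-reflexive; ≤-<-trans; <⇒≤; <⇒≢; <-cmp; m≤m+n; m<n+m;
         0≢1+n; suc-injective; +-identityʳ; +-cancelˡ-≡; *-distribʳ-+)
open import Data.Nat.Tactic.RingSolver using (solve-∀)
open import Data.Product using (Σ; _×_; _,_; proj₁; proj₂; uncurry)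
open import Data.Product.Function.Dependent.Propositional using (Σ-↔)
open import Data.Product.Properties using (Σ-≡,≡→≡)
open import Data.Sum using (_⊎_; inj₁; inj₂; [_,_]′)
import Data.Sum
open import Data.Sum.Function.Propositional using (_⊎-↔_)
open import Function using (_∘_; id; const; case_of_)
open import Function.Bundles using (_↔_; Inverse; mk↔ₛ′; Injection; _⇔_; mk⇔; Equivalence)
open import Function.Construct.Composition using () renaming (equivalence to ⇔-trans)
open import Function.Construct.Identity using (⇔-id)
open import Function.Construct.Symmetry using (⇔-sym)
open import Function.Definitions using (Injective)
open import Function.Properties.Inverse using (↔-refl; ↔-sym; ↔-trans; ↔⇒↣)
open import Function.Related.Propositional using (module EquationalReasoning)
open import Function.Related.TypeIsomorphisms using (Σ-distribʳ-⊎)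
open import Induction.WellFounded using (Acc; acc)
open import Relation.Binary.Definitions using (tri<; tri≈; tri>)
open import Relation.Binary.PropositionalEquality
  using (_≡_; _≢_; refl; sym; trans; cong; cong₂; subst; subst₂; module ≡-Reasoning)
open import Relation.Nullary using (¬_; Dec; does; yes; no; contradiction)
import Relation.Nullary as Nullary
open import Relation.Nullary.Decidable
  using (False; fromWitnessFalse; toWitnessFalse; T?; does-⇔; dec-true; dec-false)
open import Relation.Unary using (Pred; Decidable; Irrelevant)

open Inverse using (to; from; strictlyInverseˡ; strictlyInverseʳ)

-- Bijections and counting in finite sets

to-injective : ∀ {A B : Set} (e : A ↔ B) → Injective _≡_ _≡_ (to e)
to-injective e = Injection.injective (↔⇒↣ e)

Fin-↔⇒≡ : ∀ {m n} → Fin m ↔ Fin n → m ≡ n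
Fin-↔⇒≡ e = cantor-schröder-bernstein (to-injective e) (to-injective (↔-sym e))

⇔⇒↔ : ∀ {A B : Set} → Nullary.Irrelevant A → Nullary.Irrelevant B → A ⇔ B → A ↔ B
⇔⇒↔ A-irr B-irr A⇔B = mk↔ₛ′ (Equivalence.to A⇔B) (Equivalence.from A⇔B) (λ _ → B-irr _ _) (λ _ → A-irr _ _)

≡⇔≡ : ∀ {A : Set} {a a′ b b′ : A} → a ≡ a′ → b ≡ b′ → (a ≡ b) ⇔ (a′ ≡ b′)
≡⇔≡ refl refl = ⇔-id _

-- The complement is `False ∘ P?` rather than `¬ P` because it has to be irrelevant.
split-Dec : ∀ {A : Set} {P : Pred A 0ℓ} (P? : Decidable P) → Irrelevant P → A ↔ (Σ A P ⊎ Σ A (False ∘ P?))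
split-Dec {A} {P} P? P-irr = mk↔ₛ′ (λ a → classify a (P? a)) [ proj₁ , proj₁ ]′ to∘from from∘to
  where
  classify : (a : A) → Dec (P a) → Σ A P ⊎ Σ A (False ∘ P?)
  classify a (yes p) = inj₁ (a , p)
  classify a (no ¬p) = inj₂ (a , fromWitnessFalse ¬p)
  to∘from : ∀ y → classify ([ proj₁ , proj₁ ]′ y) (P? ([ proj₁ , proj₁ ]′ y)) ≡ y
  to∘from (inj₁ (a , p)) = accept (P? a)
    where
    accept : ∀ d → classify a d ≡ inj₁ (a , p)
    accept (yes p′) = cong (λ p″ → inj₁ (a , p″)) (P-irr p′ p)
    accept (no ¬p)  = contradiction p ¬p
  to∘from (inj₂ (a , q)) = reject (P? a)
    where
    reject : ∀ d → classify a d ≡ inj₂ (a , q)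
    reject (yes p) = contradiction p (toWitnessFalse q)
    reject (no ¬p) = cong (λ q′ → inj₂ (a , q′)) (T-irrelevant _ q)
  from∘to : ∀ a → [ proj₁ , proj₁ ]′ (classify a (P? a)) ≡ a
  from∘to a with P? a
  ... | yes _ = refl
  ... | no _  = refl

↔Σ-fibre : ∀ {A B : Set} (f : A → B) → A ↔ Σ B (λ b → Σ A (λ a → f a ≡ b))
↔Σ-fibre f = mk↔ₛ′ (λ a → f a , a , refl) (λ (_ , a , _) → a) (λ { (_ , a , refl) → refl }) (λ _ → refl)

fibre-↔ : ∀ {A B : Set} {C : B → Set} (e : A ↔ Σ B C) (b : B) → Σ A (λ a → proj₁ (to e a) ≡ b) ↔ C b
fibre-↔ {B = B} {C} e b = ↔-trans (Σ-↔ e ↔-refl) fibre-proj₁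
  where
  fibre-proj₁ : Σ (Σ B C) (λ x → proj₁ x ≡ b) ↔ C b
  fibre-proj₁ = mk↔ₛ′ (λ { ((_ , c) , refl) → c }) (λ c → (b , c) , refl) (λ _ → refl) (λ { ((_ , c) , refl) → refl })

module _ {A : Set} {P : Pred A 0ℓ} (P? : Decidable P) (P-irr : Irrelevant P) where

  Σ↔filter-tabulate : ∀ {n} (f : Fin n → A) → Σ (Fin n) (P ∘ f) ↔ Fin (length (filter P? (tabulate f)))
  Σ↔filter-tabulate {zero} f = mk↔ₛ′ (λ ()) (λ ()) (λ ()) (λ ())
  Σ↔filter-tabulate {suc n} f with P? (f zero) | Σ↔filter-tabulate (f ∘ suc)
  ... | yes p | ih = mk↔ₛ′ to′ from′ to∘from from∘to
    where
    to′ : Σ (Fin (suc n)) (P ∘ f) → Fin _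
    to′ (zero , _)  = zero
    to′ (suc i , q) = suc (to ih (i , q))
    from′ : Fin _ → Σ (Fin (suc n)) (P ∘ f)
    from′ zero    = zero , p
    from′ (suc j) = suc (proj₁ (from ih j)) , proj₂ (from ih j)
    to∘from : ∀ j → to′ (from′ j) ≡ j
    to∘from zero    = refl
    to∘from (suc j) = cong suc (strictlyInverseˡ ih j)
    from∘to : ∀ x → from′ (to′ x) ≡ x
    from∘to (zero , q)  = cong (zero ,_) (P-irr p q)
    from∘to (suc i , q) = cong (λ (y : Σ (Fin n) (P ∘ f ∘ suc)) → suc (proj₁ y) , proj₂ y) (strictlyInverseʳ ih (i , q))
  ... | no ¬p | ih = mk↔ₛ′ to′ from′ (strictlyInverseˡ ih) from∘to
    where
    to′ : Σ (Fin (suc n)) (P ∘ f) → Fin _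
    to′ (zero , q)  = contradiction q ¬p
    to′ (suc i , q) = to ih (i , q)
    from′ : Fin _ → Σ (Fin (suc n)) (P ∘ f)
    from′ j = suc (proj₁ (from ih j)) , proj₂ (from ih j)
    from∘to : ∀ x → from′ (to′ x) ≡ x
    from∘to (zero , q)  = contradiction q ¬p
    from∘to (suc i , q) = cong (λ (y : Σ (Fin n) (P ∘ f ∘ suc)) → suc (proj₁ y) , proj₂ y) (strictlyInverseʳ ih (i , q))

-- `blockSize part X` is by definition `count (λ v → part v ≟P X)`.
count : ∀ {n} {P : Pred (Fin n) 0ℓ} → Decidable P → ℕ
count {n} P? = length (filter P? (allFin n))

Σ↔count : ∀ {n} {P : Pred (Fin n) 0ℓ} (P? : Decidable P) → Irrelevant P → Σ (Fin n) P ↔ Fin (count P?)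
Σ↔count P? P-irr = Σ↔filter-tabulate P? P-irr id

module _ {m n} {P : Pred (Fin m) 0ℓ} {Q : Pred (Fin n) 0ℓ} (P? : Decidable P) (Q? : Decidable Q)
         (P-irr : Irrelevant P) (Q-irr : Irrelevant Q) where

  count-cong-↔ : Σ (Fin m) P ↔ Σ (Fin n) Q → count P? ≡ count Q?
  count-cong-↔ e = Fin-↔⇒≡ (↔-trans (↔-sym (Σ↔count P? P-irr)) (↔-trans e (Σ↔count Q? Q-irr)))

  count-cong : (e : Fin m ↔ Fin n) → (∀ i → P i ⇔ Q (to e i)) → count P? ≡ count Q?
  count-cong e P⇔Q = count-cong-↔ (Σ-↔ e (λ {i} → ⇔⇒↔ P-irr Q-irr (P⇔Q i)))

  count-mono : (f : Fin m → Fin n) → Injective _≡_ _≡_ f → (∀ {i} → P i → Q (f i)) → count P? ≤ count Q?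
  count-mono f f-inj f-PQ = injective⇒≤ g-inj
    where
    ΣP = Σ↔count P? P-irr
    ΣQ = Σ↔count Q? Q-irr
    g : Fin (count P?) → Fin (count Q?)
    g x = to ΣQ (f (proj₁ (from ΣP x)) , f-PQ (proj₂ (from ΣP x)))
    g-inj : Injective _≡_ _≡_ g
    g-inj {x} {y} gx≡gy = begin
      x                   ≡⟨ strictlyInverseˡ ΣP x ⟨
      to ΣP (from ΣP x)   ≡⟨ cong (to ΣP) (Σ-≡,≡→≡ (f-inj (cong proj₁ (to-injective ΣQ gx≡gy)) , P-irr _ _)) ⟩
      to ΣP (from ΣP y)   ≡⟨ strictlyInverseˡ ΣP y ⟩
      y                   ∎
      where open ≡-Reasoning

count-all : ∀ {n} {P : Pred (Fin n) 0ℓ} (P? : Decidable P) → (∀ i → P i) → count P? ≡ n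
count-all {n} P? all = trans (cong length (filter-all P? (All.tabulate⁺ all))) (length-tabulate id)

count-none : ∀ {n} {P : Pred (Fin n) 0ℓ} (P? : Decidable P) → (∀ i → ¬ P i) → count P? ≡ 0
count-none P? none = cong length (filter-none P? (All.tabulate⁺ none))

count-+ : ∀ a b {P : Pred (Fin (a + b)) 0ℓ} (P? : Decidable P) → Irrelevant P →
          count P? ≡ count (P? ∘ (_↑ˡ b)) + count (P? ∘ (a ↑ʳ_))
count-+ a b {P} P? P-irr = Fin-↔⇒≡ (begin
  Fin (count P?)                                              ↔⟨ ↔-sym (Σ↔count P? P-irr) ⟩
  Σ (Fin (a + b)) P                                           ↔⟨ ↔-sym (Σ-↔ (↔-sym +↔⊎) ↔-refl) ⟩
  Σ (Fin a ⊎ Fin b) (P ∘ join a b)                            ↔⟨ Σ-distribʳ-⊎ ⟩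
  (Σ (Fin a) (P ∘ (_↑ˡ b)) ⊎ Σ (Fin b) (P ∘ (a ↑ʳ_)))         ↔⟨ Σ↔count _ P-irr ⊎-↔ Σ↔count _ P-irr ⟩
  (Fin (count (P? ∘ (_↑ˡ b))) ⊎ Fin (count (P? ∘ (a ↑ʳ_))))   ↔⟨ ↔-sym +↔⊎ ⟩
  Fin (count (P? ∘ (_↑ˡ b)) + count (P? ∘ (a ↑ʳ_)))           ∎)
  where open EquationalReasoning

-- Equivalence relations on finite sets, presented as kernels of labellings

record KernelIso {A B : Set} (c : A → ℕ) (d : B → ℕ) : Set where
  field
    bijection : A ↔ B
    preserves : ∀ x y → c x ≡ c y ⇔ d (to bijection x) ≡ d (to bijection y)

open KernelIso

KernelIso-via : ∀ {A B : Set} (c : A → ℕ) (e : A ↔ B) → KernelIso c (c ∘ from e)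
KernelIso-via c e = record
  { bijection = e
  ; preserves = λ x y → ≡⇔≡ (sym (cong c (strictlyInverseʳ e x))) (sym (cong c (strictlyInverseʳ e y))) }

KernelIso-sym : ∀ {A B : Set} {c : A → ℕ} {d : B → ℕ} → KernelIso c d → KernelIso d c
KernelIso-sym {d = d} K = record
  { bijection = ↔-sym e
  ; preserves = λ x y → ⇔-sym (⇔-trans (preserves K (from e x) (from e y))
                                        (≡⇔≡ (cong d (strictlyInverseˡ e x)) (cong d (strictlyInverseˡ e y)))) }
  where e = bijection K

KernelIso-trans : ∀ {A B C : Set} {c : A → ℕ} {d : B → ℕ} {e : C → ℕ} → KernelIso c d → KernelIso d e → KernelIso c e
KernelIso-trans K L = record
  { bijection = ↔-trans (bijection K) (bijection L)
  ; preserves = λ x y → ⇔-trans (preserves K x y) (preserves L _ _) }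

blockLabel : (λs : List ℕ) → Fin (sum λs) → ℕ
blockLabel []       ()
blockLabel (a ∷ λs) i = [ const 0 , suc ∘ blockLabel λs ]′ (splitAt a i)

blockLabel-↑ˡ : ∀ a λs (i : Fin a) → blockLabel (a ∷ λs) (i ↑ˡ sum λs) ≡ 0
blockLabel-↑ˡ a λs i = cong [ const 0 , suc ∘ blockLabel λs ]′ (splitAt-↑ˡ a i (sum λs))

blockLabel-↑ʳ : ∀ a λs (j : Fin (sum λs)) → blockLabel (a ∷ λs) (a ↑ʳ j) ≡ suc (blockLabel λs j)
blockLabel-↑ʳ a λs j = cong [ const 0 , suc ∘ blockLabel λs ]′ (splitAt-↑ʳ a (sum λs) j)

KernelIso-cons : ∀ {A B : Set} {k} {λs} (c : A ⊎ B → ℕ) → A ↔ Fin k →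
                 (∀ x y → c (inj₁ x) ≡ c (inj₁ y)) → (∀ x y → c (inj₁ x) ≢ c (inj₂ y)) →
                 KernelIso (c ∘ inj₂) (blockLabel λs) → KernelIso c (blockLabel (k ∷ λs))
KernelIso-cons {A} {B} {k} {λs} c A↔k c-constant c-separates K = record { bijection = e ; preserves = preserves′ }
  where
  e : (A ⊎ B) ↔ Fin (k + sum λs)
  e = ↔-trans (A↔k ⊎-↔ bijection K) (↔-sym +↔⊎)
  label₀ : ∀ x → blockLabel (k ∷ λs) (to e (inj₁ x)) ≡ 0
  label₀ x = blockLabel-↑ˡ k λs (to A↔k x)
  labelₛ : ∀ y → blockLabel (k ∷ λs) (to e (inj₂ y)) ≡ suc (blockLabel λs (to (bijection K) y))
  labelₛ y = blockLabel-↑ʳ k λs (to (bijection K) y)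
  preserves′ : ∀ x y → c x ≡ c y ⇔ blockLabel (k ∷ λs) (to e x) ≡ blockLabel (k ∷ λs) (to e y)
  preserves′ (inj₁ x) (inj₁ y) = mk⇔ (λ _ → trans (label₀ x) (sym (label₀ y))) (λ _ → c-constant x y)
  preserves′ (inj₁ x) (inj₂ y) = mk⇔ (λ eq → contradiction eq (c-separates x y))
                                     (λ eq → contradiction (trans (sym (label₀ x)) (trans eq (labelₛ y))) 0≢1+n)
  preserves′ (inj₂ x) (inj₁ y) = mk⇔ (λ eq → contradiction (sym eq) (c-separates y x))
                                     (λ eq → contradiction (trans (sym (label₀ y)) (trans (sym eq) (labelₛ x))) 0≢1+n)
  preserves′ (inj₂ x) (inj₂ y) = ⇔-trans (preserves K x y)
                                   (⇔-trans (mk⇔ (cong suc) suc-injective) (≡⇔≡ (sym (labelₛ x)) (sym (labelₛ y))))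

classSize : ∀ {n} → (Fin n → ℕ) → Fin n → ℕ
classSize c i = count (λ j → c j ≟ c i)

classSize≤n : ∀ {n} (c : Fin n → ℕ) i → classSize c i ≤ n
classSize≤n {n} c i = ≤-trans (length-filter (λ j → c j ≟ c i) (allFin n)) (≤-reflexive (length-tabulate id))

argmax : ∀ {n} (h : Fin (suc n) → ℕ) → Σ (Fin (suc n)) λ i → ∀ j → h j ≤ h i
argmax {zero} h = zero , λ { zero → ≤-refl }
argmax {suc n} h with argmax (h ∘ suc)
... | i , max with ≤-total (h zero) (h (suc i))
...   | inj₁ h₀≤hᵢ = suc i , λ { zero → h₀≤hᵢ ; (suc j) → max j }
...   | inj₂ hᵢ≤h₀ = zero , λ { zero → ≤-refl ; (suc j) → ≤-trans (max j) hᵢ≤h₀ }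

record BoundedType {n} (c : Fin n → ℕ) (B : ℕ) : Set where
  field
    parts      : List ℕ
    positive   : All (1 ≤_) parts
    bounded    : Connected _≥_ (just B) (head parts)
    descending : Linked _≥_ parts
    kernelIso  : KernelIso c (blockLabel parts)

-- Split off a largest class and recurse on the rest, whose classes are then no larger.
boundedType : ∀ {n} → Acc _<_ n → (c : Fin n → ℕ) (B : ℕ) → (∀ i → classSize c i ≤ B) → BoundedType c B
boundedType {zero} _ c B _ = record
  { parts = [] ; positive = [] ; bounded = just-nothing ; descending = []
  ; kernelIso = record { bijection = ↔-refl ; preserves = λ () } }
boundedType {suc n} (acc smaller) c B classSize≤B = record
  { parts      = k ∷ parts rest
  ; positive   = 1≤k ∷ positive rest
  ; bounded    = just (classSize≤B i₀)
  ; descending = bounded rest ∷′ descending rest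
  ; kernelIso  = KernelIso-trans (KernelIso-via c split) splitIso }
  where
  open BoundedType
  i₀ = proj₁ (argmax (classSize c))
  k = classSize c i₀
  Class? : Decidable (λ j → c j ≡ c i₀)
  Class? j = c j ≟ c i₀
  Class↔k : Σ (Fin (suc n)) (λ j → c j ≡ c i₀) ↔ Fin k
  Class↔k = Σ↔count Class? ≡-irrelevant
  split : Fin (suc n) ↔ (Σ (Fin (suc n)) (λ j → c j ≡ c i₀) ⊎ Σ (Fin (suc n)) (False ∘ Class?))
  split = split-Dec Class? ≡-irrelevant
  Rest? : Decidable (False ∘ Class?)
  Rest? j = T? _
  r = count Rest?
  Rest↔r : Σ (Fin (suc n)) (False ∘ Class?) ↔ Fin r
  Rest↔r = Σ↔count Rest? T-irrelevant
  c′ : Fin r → ℕ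
  c′ = c ∘ proj₁ ∘ from Rest↔r
  1≤k : 1 ≤ k
  1≤k = >-nonZero⁻¹ k {{nonZeroIndex (to Class↔k (i₀ , refl))}}
  r<1+n : r < suc n
  r<1+n = subst (r <_) (Fin-↔⇒≡ (↔-trans +↔⊎ (↔-sym (↔-trans split (Class↔k ⊎-↔ Rest↔r))))) (m<n+m r 1≤k)
  c′-classSize≤k : ∀ j → classSize c′ j ≤ k
  c′-classSize≤k j = ≤-trans
    (count-mono (λ j′ → c′ j′ ≟ c′ j) (λ i → c i ≟ c′ j) ≡-irrelevant ≡-irrelevant (proj₁ ∘ from Rest↔r)
                (λ eq → to-injective (↔-sym Rest↔r) (Σ-≡,≡→≡ (eq , T-irrelevant _ _))) id)
    (proj₂ (argmax (classSize c)) (proj₁ (from Rest↔r j)))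
  rest : BoundedType c′ k
  rest = boundedType (smaller r<1+n) c′ k c′-classSize≤k
  splitIso : KernelIso (c ∘ from split) (blockLabel (k ∷ parts rest))
  splitIso = KernelIso-cons {λs = parts rest} (c ∘ from split) Class↔k
               (λ x y → trans (proj₂ x) (sym (proj₂ y)))
               (λ x y eq → toWitnessFalse (proj₂ y) (trans (sym eq) (proj₂ x)))
               (KernelIso-trans (KernelIso-via (c ∘ proj₁) Rest↔r) (kernelIso rest))

partitionType : ∀ {A : Set} {n} (c : A → ℕ) → A ↔ Fin n →
                Σ (List ℕ) λ λs → IsPartition n λs × KernelIso c (blockLabel λs)
partitionType {n = n} c A↔n =
  parts t , (positive t , descending t , sym (Fin-↔⇒≡ (bijection (kernelIso t)))) ,
  KernelIso-trans (KernelIso-via c A↔n) (kernelIso t)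
  where
  open BoundedType
  t = boundedType (<-wellFounded n) (c ∘ from A↔n) n (classSize≤n (c ∘ from A↔n))

classSize-KernelIso : ∀ {m n} {c : Fin m → ℕ} {d : Fin n → ℕ} (K : KernelIso c d) →
                      ∀ i → classSize c i ≡ classSize d (to (bijection K) i)
classSize-KernelIso K i = count-cong _ _ ≡-irrelevant ≡-irrelevant (bijection K) (λ j → preserves K j i)

classSizeCount : ∀ {n} → (Fin n → ℕ) → ℕ → ℕ
classSizeCount c k = count (λ i → classSize c i ≟ k)

classSizeCount-KernelIso : ∀ {m n} {c : Fin m → ℕ} {d : Fin n → ℕ} → KernelIso c d →
                           ∀ k → classSizeCount c k ≡ classSizeCount d k
classSizeCount-KernelIso K k =
  count-cong _ _ ≡-irrelevant ≡-irrelevant (bijection K) (λ i → ≡⇔≡ (classSize-KernelIso K i) refl)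

classSize-blockLabel-↑ˡ : ∀ a λs (i : Fin a) → classSize (blockLabel (a ∷ λs)) (i ↑ˡ sum λs) ≡ a
classSize-blockLabel-↑ˡ a λs i = begin
  classSize L (i ↑ˡ sum λs)                         ≡⟨ count-+ a (sum λs) _ ≡-irrelevant ⟩
  count (λ j → L (j ↑ˡ sum λs) ≟ L (i ↑ˡ sum λs)) +
  count (λ j → L (a ↑ʳ j) ≟ L (i ↑ˡ sum λs))        ≡⟨ cong₂ _+_ (count-all _ first-block)
                                                                 (count-none _ later-blocks) ⟩
  a + 0                                             ≡⟨ +-identityʳ a ⟩
  a                                                 ∎
  where
  open ≡-Reasoning
  L = blockLabel (a ∷ λs)
  first-block : ∀ j → L (j ↑ˡ sum λs) ≡ L (i ↑ˡ sum λs)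
  first-block j = trans (blockLabel-↑ˡ a λs j) (sym (blockLabel-↑ˡ a λs i))
  later-blocks : ∀ j → L (a ↑ʳ j) ≢ L (i ↑ˡ sum λs)
  later-blocks j eq = 0≢1+n (trans (sym (blockLabel-↑ˡ a λs i)) (trans (sym eq) (blockLabel-↑ʳ a λs j)))

classSize-blockLabel-↑ʳ : ∀ a λs (j : Fin (sum λs)) →
                          classSize (blockLabel (a ∷ λs)) (a ↑ʳ j) ≡ classSize (blockLabel λs) j
classSize-blockLabel-↑ʳ a λs j = begin
  classSize L (a ↑ʳ j)                              ≡⟨ count-+ a (sum λs) _ ≡-irrelevant ⟩
  count (λ i → L (i ↑ˡ sum λs) ≟ L (a ↑ʳ j)) +
  count (λ i → L (a ↑ʳ i) ≟ L (a ↑ʳ j))             ≡⟨ cong₂ _+_ (count-none _ first-block)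
                                                                 (count-cong _ _ ≡-irrelevant ≡-irrelevant ↔-refl later-blocks) ⟩
  0 + classSize (blockLabel λs) j                   ∎
  where
  open ≡-Reasoning
  L = blockLabel (a ∷ λs)
  first-block : ∀ i → L (i ↑ˡ sum λs) ≢ L (a ↑ʳ j)
  first-block i eq = 0≢1+n (trans (sym (blockLabel-↑ˡ a λs i)) (trans eq (blockLabel-↑ʳ a λs j)))
  later-blocks : ∀ i → L (a ↑ʳ i) ≡ L (a ↑ʳ j) ⇔ blockLabel λs i ≡ blockLabel λs j
  later-blocks i = ⇔-trans (≡⇔≡ (blockLabel-↑ʳ a λs i) (blockLabel-↑ʳ a λs j)) (mk⇔ suc-injective (cong suc))

sum-filter-∷ : ∀ a λs k → sum (filter (_≟ k) (a ∷ λs)) ≡ sum (filter (_≟ k) (a ∷ [])) + sum (filter (_≟ k) λs)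
sum-filter-∷ a λs k = trans (cong sum (filter-++ (_≟ k) (a ∷ []) λs)) (sum-++ (filter (_≟ k) (a ∷ [])) (filter (_≟ k) λs))

classSizeCount-blockLabel : ∀ λs k → classSizeCount (blockLabel λs) k ≡ sum (filter (_≟ k) λs)
classSizeCount-blockLabel []       k = refl
classSizeCount-blockLabel (a ∷ λs) k = begin
  classSizeCount L k                                      ≡⟨ count-+ a (sum λs) _ ≡-irrelevant ⟩
  count (λ i → classSize L (i ↑ˡ sum λs) ≟ k) +
  count (λ j → classSize L (a ↑ʳ j) ≟ k)                  ≡⟨ cong₂ _+_ first-block later-blocks ⟩
  count {a} (λ _ → a ≟ k) + sum (filter (_≟ k) λs)        ≡⟨ cong (_+ sum (filter (_≟ k) λs)) constant ⟩
  sum (filter (_≟ k) (a ∷ [])) + sum (filter (_≟ k) λs)   ≡⟨ sum-filter-∷ a λs k ⟨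
  sum (filter (_≟ k) (a ∷ λs))                            ∎
  where
  open ≡-Reasoning
  L = blockLabel (a ∷ λs)
  first-block : count (λ i → classSize L (i ↑ˡ sum λs) ≟ k) ≡ count {a} (λ _ → a ≟ k)
  first-block = count-cong _ _ ≡-irrelevant ≡-irrelevant ↔-refl (λ i → ≡⇔≡ (classSize-blockLabel-↑ˡ a λs i) refl)
  later-blocks : count (λ j → classSize L (a ↑ʳ j) ≟ k) ≡ sum (filter (_≟ k) λs)
  later-blocks = trans
    (count-cong _ _ ≡-irrelevant ≡-irrelevant ↔-refl (λ j → ≡⇔≡ (classSize-blockLabel-↑ʳ a λs j) refl))
    (classSizeCount-blockLabel λs k)
  constant : count {a} (λ _ → a ≟ k) ≡ sum (filter (_≟ k) (a ∷ []))
  constant with a ≟ k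
  ... | yes a≡k = trans (count-all (λ _ → yes a≡k) (λ _ → a≡k))
                        (sym (trans (cong sum (filter-accept (_≟ k) a≡k)) (+-identityʳ a)))
  ... | no a≢k  = trans (count-none {a} (λ _ → no a≢k) (λ _ → a≢k)) (sym (cong sum (filter-reject (_≟ k) a≢k)))

descending⇒all< : ∀ {a b λs} → Linked _≥_ (a ∷ λs) → a < b → All (_< b) (a ∷ λs)
descending⇒all< λs↓ a<b =
  All.map (λ x≤a → ≤-<-trans x≤a a<b) (Linked⇒All (λ x≥y y≥z → ≤-trans y≥z x≥y) ≤-refl λs↓)

sum-filter-below≢ : ∀ {k λs μs} → 1 ≤ k → All (_< k) λs → sum (filter (_≟ k) λs) ≢ sum (filter (_≟ k) (k ∷ μs))
sum-filter-below≢ {k} {λs} {μs} 1≤k λs<k eq =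
  <⇒≢ 0<rhs (trans (sym (cong sum (filter-none (_≟ k) (All.map <⇒≢ λs<k)))) eq)
  where
  0<rhs : 0 < sum (filter (_≟ k) (k ∷ μs))
  0<rhs = ≤-trans 1≤k (subst (k ≤_) (sym (cong sum (filter-accept (_≟ k) refl))) (m≤m+n k _))

-- Compare the largest parts: the larger one is seen by `filter (_≟ k)` in only one of the lists.
descending-unique : ∀ {λs μs} → All (1 ≤_) λs → All (1 ≤_) μs → Linked _≥_ λs → Linked _≥_ μs →
                    (∀ k → sum (filter (_≟ k) λs) ≡ sum (filter (_≟ k) μs)) → λs ≡ μs
descending-unique [] [] _ _ _ = refl
descending-unique [] (1≤b ∷ _) _ _ eq = contradiction (eq _) (sum-filter-below≢ 1≤b [])
descending-unique (1≤a ∷ _) [] _ _ eq = contradiction (sym (eq _)) (sum-filter-below≢ 1≤a [])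
descending-unique {a ∷ λs} {b ∷ μs} (1≤a ∷ λs⁺) (1≤b ∷ μs⁺) λs↓ μs↓ eq with <-cmp a b
... | tri< a<b _ _ = contradiction (eq b) (sum-filter-below≢ 1≤b (descending⇒all< λs↓ a<b))
... | tri> _ _ b<a = contradiction (sym (eq a)) (sum-filter-below≢ 1≤a (descending⇒all< μs↓ b<a))
... | tri≈ _ refl _ = cong (a ∷_) (descending-unique λs⁺ μs⁺ (Linked.tail λs↓) (Linked.tail μs↓) λ k →
                        +-cancelˡ-≡ (sum (filter (_≟ k) (a ∷ []))) _ _
                          (trans (sym (sum-filter-∷ a λs k)) (trans (eq k) (sum-filter-∷ a μs k))))

partition-unique : ∀ {p λs μs} → IsPartition p λs → IsPartition p μs →
                   KernelIso (blockLabel λs) (blockLabel μs) → λs ≡ μs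
partition-unique {λs = λs} {μs} (λs⁺ , λs↓ , _) (μs⁺ , μs↓ , _) K =
  descending-unique λs⁺ μs⁺ λs↓ μs↓ λ k → begin
  sum (filter (_≟ k) λs)              ≡⟨ classSizeCount-blockLabel λs k ⟨
  classSizeCount (blockLabel λs) k    ≡⟨ classSizeCount-KernelIso K k ⟩
  classSizeCount (blockLabel μs) k    ≡⟨ classSizeCount-blockLabel μs k ⟩
  sum (filter (_≟ k) μs)              ∎
  where open ≡-Reasoning

-- The adjacency rule of SI-core graphs

does≡true⇔ : ∀ {A : Set} (a? : Dec A) → does a? ≡ true ⇔ A
does≡true⇔ (yes a) = mk⇔ (const a) (const refl)
does≡true⇔ (no ¬a) = mk⇔ (λ ()) (λ a → contradiction a ¬a)

≡does : ∀ {A : Set} {b : Bool} → b ≡ true ⇔ A → (a? : Dec A) → b ≡ does a?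
≡does {b = true}  b⇔A a? = sym (dec-true a? (Equivalence.to b⇔A refl))
≡does {b = false} b⇔A a? = sym (dec-false a? (λ a → case Equivalence.from b⇔A a of λ ()))

-- Adjacency between two distinct vertices, given their blocks and clique labels.
coreAdj : Part → ℕ → Part → ℕ → Bool
coreAdj P₁ c P₁ d = does (c ≟ d)
coreAdj P₂ c P₂ d = does (c ≟ d)
coreAdj P₁ _ P₂ _ = false
coreAdj P₂ _ P₁ _ = false
coreAdj S₁ _ P₂ _ = false
coreAdj P₂ _ S₁ _ = false
coreAdj S₂ _ P₁ _ = false
coreAdj P₁ _ S₂ _ = false
coreAdj _  _ _  _ = true

coreAdj-sym : ∀ X c Y d → coreAdj X c Y d ≡ coreAdj Y d X c
coreAdj-sym S₁ c S₁ d = refl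
coreAdj-sym S₁ c S₂ d = refl
coreAdj-sym S₁ c P₁ d = refl
coreAdj-sym S₁ c P₂ d = refl
coreAdj-sym S₂ c S₁ d = refl
coreAdj-sym S₂ c S₂ d = refl
coreAdj-sym S₂ c P₁ d = refl
coreAdj-sym S₂ c P₂ d = refl
coreAdj-sym P₁ c S₁ d = refl
coreAdj-sym P₁ c S₂ d = refl
coreAdj-sym P₁ c P₁ d = does-⇔ (mk⇔ sym sym) (c ≟ d) (d ≟ c)
coreAdj-sym P₁ c P₂ d = refl
coreAdj-sym P₂ c S₁ d = refl
coreAdj-sym P₂ c S₂ d = refl
coreAdj-sym P₂ c P₁ d = refl
coreAdj-sym P₂ c P₂ d = does-⇔ (mk⇔ sym sym) (c ≟ d) (d ≟ c)

coreAdj-cong : ∀ X Y {c d c′ d′} → (X ≡ Y → IsP X → c ≡ d ⇔ c′ ≡ d′) → coreAdj X c Y d ≡ coreAdj X c′ Y d′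
coreAdj-cong P₁ P₁ {c} {d} {c′} {d′} h = does-⇔ (h refl (inj₁ refl)) (c ≟ d) (c′ ≟ d′)
coreAdj-cong P₂ P₂ {c} {d} {c′} {d′} h = does-⇔ (h refl (inj₂ refl)) (c ≟ d) (c′ ≟ d′)
coreAdj-cong S₁ S₁ _ = refl
coreAdj-cong S₁ S₂ _ = refl
coreAdj-cong S₁ P₁ _ = refl
coreAdj-cong S₁ P₂ _ = refl
coreAdj-cong S₂ S₁ _ = refl
coreAdj-cong S₂ S₂ _ = refl
coreAdj-cong S₂ P₁ _ = refl
coreAdj-cong S₂ P₂ _ = refl
coreAdj-cong P₁ S₁ _ = refl
coreAdj-cong P₁ S₂ _ = refl
coreAdj-cong P₁ P₂ _ = refl
coreAdj-cong P₂ S₁ _ = refl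
coreAdj-cong P₂ S₂ _ = refl
coreAdj-cong P₂ P₁ _ = refl

coreAdj-S-S : ∀ {X Y} c d → IsS X → IsS Y → coreAdj X c Y d ≡ true
coreAdj-S-S c d (inj₁ refl) (inj₁ refl) = refl
coreAdj-S-S c d (inj₁ refl) (inj₂ refl) = refl
coreAdj-S-S c d (inj₂ refl) (inj₁ refl) = refl
coreAdj-S-S c d (inj₂ refl) (inj₂ refl) = refl

coreAdj-ownS : ∀ {X} c d → IsP X → coreAdj X c (ownS X) d ≡ true
coreAdj-ownS c d (inj₁ refl) = refl
coreAdj-ownS c d (inj₂ refl) = refl

coreAdj-otherS : ∀ {X} c d → IsP X → coreAdj X c (otherS X) d ≡ false
coreAdj-otherS c d (inj₁ refl) = refl
coreAdj-otherS c d (inj₂ refl) = refl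

coreAdj-otherP : ∀ {X} c d → IsP X → coreAdj X c (otherP X) d ≡ false
coreAdj-otherP c d (inj₁ refl) = refl
coreAdj-otherP c d (inj₂ refl) = refl

coreAdj-same : ∀ {X} c d → IsP X → coreAdj X c X d ≡ does (c ≟ d)
coreAdj-same c d (inj₁ refl) = refl
coreAdj-same c d (inj₂ refl) = refl

coreAdj-P-true : ∀ {X} c Y d → IsP X → coreAdj X c Y d ≡ true → Y ≡ ownS X ⊎ (Y ≡ X × c ≡ d)
coreAdj-P-true c S₁ d (inj₁ refl) _  = inj₁ refl
coreAdj-P-true c S₂ d (inj₁ refl) ()
coreAdj-P-true c P₁ d (inj₁ refl) eq = inj₂ (refl , Equivalence.to (does≡true⇔ (c ≟ d)) eq)
coreAdj-P-true c P₂ d (inj₁ refl) ()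
coreAdj-P-true c S₁ d (inj₂ refl) ()
coreAdj-P-true c S₂ d (inj₂ refl) _  = inj₁ refl
coreAdj-P-true c P₁ d (inj₂ refl) ()
coreAdj-P-true c P₂ d (inj₂ refl) eq = inj₂ (refl , Equivalence.to (does≡true⇔ (c ≟ d)) eq)

IsS⊎IsP : ∀ X → IsS X ⊎ IsP X
IsS⊎IsP S₁ = inj₁ (inj₁ refl)
IsS⊎IsP S₂ = inj₁ (inj₂ refl)
IsS⊎IsP P₁ = inj₂ (inj₁ refl)
IsS⊎IsP P₂ = inj₂ (inj₂ refl)

IsS-ownS : ∀ {X} → IsP X → IsS (ownS X)
IsS-ownS (inj₁ refl) = inj₁ refl
IsS-ownS (inj₂ refl) = inj₂ refl

IsS-otherS : ∀ {X} → IsP X → IsS (otherS X)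
IsS-otherS (inj₁ refl) = inj₂ refl
IsS-otherS (inj₂ refl) = inj₁ refl

IsP⇒≢ownS : ∀ {X} → IsP X → X ≢ ownS X
IsP⇒≢ownS (inj₁ refl) ()
IsP⇒≢ownS (inj₂ refl) ()

IsP⇒≢otherS : ∀ {X} → IsP X → X ≢ otherS X
IsP⇒≢otherS (inj₁ refl) ()
IsP⇒≢otherS (inj₂ refl) ()

IsP⇒≢otherP : ∀ {X} → IsP X → X ≢ otherP X
IsP⇒≢otherP (inj₁ refl) ()
IsP⇒≢otherP (inj₂ refl) ()

ownS≢otherS : ∀ {X} → IsP X → ownS X ≢ otherS X
ownS≢otherS (inj₁ refl) ()
ownS≢otherS (inj₂ refl) ()

ownS-idem : ∀ X → ownS (ownS X) ≡ ownS X
ownS-idem S₁ = refl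
ownS-idem S₂ = refl
ownS-idem P₁ = refl
ownS-idem P₂ = refl

ownS-injective : ∀ {X Y} → IsP X → IsP Y → ownS X ≡ ownS Y → X ≡ Y
ownS-injective (inj₁ refl) (inj₁ refl) _ = refl
ownS-injective (inj₂ refl) (inj₂ refl) _ = refl
ownS-injective (inj₁ refl) (inj₂ refl) ()
ownS-injective (inj₂ refl) (inj₁ refl) ()

module _ {s p n : ℕ} {G : Graph n} (d : SICore s p (n , G)) where
  open SICore d hiding (n; G)

  adj≡coreAdj : ∀ u v → u ≢ v → adj G u v ≡ coreAdj (part u) (comp u) (part v) (comp v)
  adj≡coreAdj u v u≢v with part u in eu | part v in ev
  ... | S₁ | S₁ = clique u v u≢v (inj₁ eu) (inj₁ ev)
  ... | S₁ | S₂ = clique u v u≢v (inj₁ eu) (inj₂ ev)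
  ... | S₂ | S₁ = clique u v u≢v (inj₂ eu) (inj₁ ev)
  ... | S₂ | S₂ = clique u v u≢v (inj₂ eu) (inj₂ ev)
  ... | S₁ | P₁ = trans (symm G u v) (toOwnS v u (inj₁ ev) (trans eu (cong ownS (sym ev))))
  ... | S₂ | P₂ = trans (symm G u v) (toOwnS v u (inj₂ ev) (trans eu (cong ownS (sym ev))))
  ... | S₁ | P₂ = trans (symm G u v) (noOtherS v u (inj₂ ev) (trans eu (cong otherS (sym ev))))
  ... | S₂ | P₁ = trans (symm G u v) (noOtherS v u (inj₁ ev) (trans eu (cong otherS (sym ev))))
  ... | P₁ | S₁ = toOwnS u v (inj₁ eu) (trans ev (cong ownS (sym eu)))
  ... | P₂ | S₂ = toOwnS u v (inj₂ eu) (trans ev (cong ownS (sym eu)))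
  ... | P₁ | S₂ = noOtherS u v (inj₁ eu) (trans ev (cong otherS (sym eu)))
  ... | P₂ | S₁ = noOtherS u v (inj₂ eu) (trans ev (cong otherS (sym eu)))
  ... | P₁ | P₂ = noOtherP u v (inj₁ eu) (trans ev (cong otherP (sym eu)))
  ... | P₂ | P₁ = noOtherP u v (inj₂ eu) (trans ev (cong otherP (sym eu)))
  ... | P₁ | P₁ = ≡does (cluster u v u≢v (inj₁ eu) (trans ev (sym eu))) (comp u ≟ comp v)
  ... | P₂ | P₂ = ≡does (cluster u v u≢v (inj₂ eu) (trans ev (sym eu))) (comp u ≟ comp v)

module _ {n} (part : Fin n → Part) (comp : Fin n → ℕ) where

  labelAdj : Fin n → Fin n → Bool
  labelAdj u v with u ≟F v
  ... | yes _ = false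
  ... | no _  = coreAdj (part u) (comp u) (part v) (comp v)

  labelAdj-≢ : ∀ {u v Y} → u ≢ v → part v ≡ Y → labelAdj u v ≡ coreAdj (part u) (comp u) Y (comp v)
  labelAdj-≢ {u} {v} u≢v refl with u ≟F v
  ... | yes u≡v = contradiction u≡v u≢v
  ... | no _    = refl

  labelGraph : Graph n
  labelGraph = record { adj = labelAdj ; symm = labelAdj-sym ; irrefl = labelAdj-irrefl }
    where
    labelAdj-sym : ∀ u v → labelAdj u v ≡ labelAdj v u
    labelAdj-sym u v with u ≟F v | v ≟F u
    ... | yes _   | yes _   = refl
    ... | no _    | no _    = coreAdj-sym (part u) (comp u) (part v) (comp v)
    ... | yes u≡v | no v≢u  = contradiction (sym u≡v) v≢u
    ... | no u≢v  | yes v≡u = contradiction (sym v≡u) u≢v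
    labelAdj-irrefl : ∀ v → labelAdj v v ≡ false
    labelAdj-irrefl v with v ≟F v
    ... | yes _  = refl
    ... | no v≢v = contradiction refl v≢v

  labelGraph-SICore : ∀ {s p} → blockSize part S₁ ≡ s → blockSize part S₂ ≡ s →
                      blockSize part P₁ ≡ p → blockSize part P₂ ≡ p → SICore s p (n , labelGraph)
  labelGraph-SICore |S₁| |S₂| |P₁| |P₂| = record
    { part = part ; sizeS₁ = |S₁| ; sizeS₂ = |S₂| ; sizeP₁ = |P₁| ; sizeP₂ = |P₂|
    ; clique   = λ u v u≢v Su Sv → trans (labelAdj-≢ u≢v refl) (coreAdj-S-S (comp u) (comp v) Su Sv)
    ; toOwnS   = λ u v Pu ev → trans (labelAdj-≢ (parts-differ ownS (IsP⇒≢ownS Pu) ev) ev) (coreAdj-ownS _ _ Pu)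
    ; noOtherS = λ u v Pu ev → trans (labelAdj-≢ (parts-differ otherS (IsP⇒≢otherS Pu) ev) ev) (coreAdj-otherS _ _ Pu)
    ; noOtherP = λ u v Pu ev → trans (labelAdj-≢ (parts-differ otherP (IsP⇒≢otherP Pu) ev) ev) (coreAdj-otherP _ _ Pu)
    ; comp     = comp
    ; cluster  = λ u v u≢v Pu ev → subst (λ b → b ≡ true ⇔ comp u ≡ comp v)
                   (sym (trans (labelAdj-≢ u≢v ev) (coreAdj-same _ _ Pu))) (does≡true⇔ (comp u ≟ comp v)) }
    where
    parts-differ : ∀ {u v} (f : Part → Part) → part u ≢ f (part u) → part v ≡ f (part u) → u ≢ v
    parts-differ _ ≢f ev refl = ≢f ev

module _ {s p s′ p′ n m} {G : Graph n} {H : Graph m} (dG : SICore s p (n , G)) (dH : SICore s′ p′ (m , H)) where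
  private
    module G = SICore dG
    module H = SICore dH

  SICore-Iso : (σ : Part → Part) → (∀ X c Y d → coreAdj (σ X) c (σ Y) d ≡ coreAdj X c Y d) →
               (f : Fin n ↔ Fin m) → (∀ u → H.part (to f u) ≡ σ (G.part u)) →
               (∀ u v → G.part u ≡ G.part v → IsP (G.part u) →
                  G.comp u ≡ G.comp v ⇔ H.comp (to f u) ≡ H.comp (to f v)) →
               Iso (n , G) (m , H)
  SICore-Iso σ σ-coreAdj f part-f comp-f = f , adj-f
    where
    adj-f : ∀ u v → adj G u v ≡ adj H (to f u) (to f v)
    adj-f u v with u ≟F v
    ... | yes refl = trans (irrefl G u) (sym (irrefl H (to f u)))
    ... | no u≢v = begin
      adj G u v                                                          ≡⟨ adj≡coreAdj dG u v u≢v ⟩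
      coreAdj (G.part u) (G.comp u) (G.part v) (G.comp v)                ≡⟨ coreAdj-cong (G.part u) (G.part v) (comp-f u v) ⟩
      coreAdj (G.part u) (H.comp (to f u)) (G.part v) (H.comp (to f v)) ≡⟨ σ-coreAdj (G.part u) _ (G.part v) _ ⟨
      coreAdj (σ (G.part u)) (H.comp (to f u)) (σ (G.part v)) (H.comp (to f v))
        ≡⟨ cong₂ (λ X Y → coreAdj X (H.comp (to f u)) Y (H.comp (to f v))) (part-f u) (part-f v) ⟨
      coreAdj (H.part (to f u)) (H.comp (to f u)) (H.part (to f v)) (H.comp (to f v))
        ≡⟨ adj≡coreAdj dH (to f u) (to f v) (u≢v ∘ to-injective f) ⟨
      adj H (to f u) (to f v)                                            ∎
      where open ≡-Reasoning

Iso-sym : ∀ {G H} → Iso G H → Iso H G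
Iso-sym {n , G} {m , H} (f , adj-f) = ↔-sym f , λ x y → sym (begin
  adj G (from f x) (from f y)                  ≡⟨ adj-f (from f x) (from f y) ⟩
  adj H (to f (from f x)) (to f (from f y))    ≡⟨ cong₂ (adj H) (strictlyInverseˡ f x) (strictlyInverseˡ f y) ⟩
  adj H x y                                    ∎)
  where open ≡-Reasoning

Iso-trans : ∀ {G H K} → Iso G H → Iso H K → Iso G K
Iso-trans (f , adj-f) (g , adj-g) = ↔-trans f g , λ u v → trans (adj-f u v) (adj-g (to f u) (to f v))

-- The canonical SI-core graphs

⊎↔ΣPart : (F : Part → Set) → (((F S₁ ⊎ F S₂) ⊎ F P₁) ⊎ F P₂) ↔ Σ Part F
⊎↔ΣPart F = mk↔ₛ′
  [ [ [ (S₁ ,_) , (S₂ ,_) ]′ , (P₁ ,_) ]′ , (P₂ ,_) ]′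
  (λ { (S₁ , x) → inj₁ (inj₁ (inj₁ x)) ; (S₂ , x) → inj₁ (inj₁ (inj₂ x))
      ; (P₁ , x) → inj₁ (inj₂ x)         ; (P₂ , x) → inj₂ x })
  (λ { (S₁ , _) → refl ; (S₂ , _) → refl ; (P₁ , _) → refl ; (P₂ , _) → refl })
  (λ { (inj₁ (inj₁ (inj₁ _))) → refl ; (inj₁ (inj₁ (inj₂ _))) → refl
      ; (inj₁ (inj₂ _))         → refl ; (inj₂ _)                 → refl })

Block : ∀ {n} → (Fin n → Part) → Part → Set
Block {n} part X = Σ (Fin n) (λ v → part v ≡ X)

Part-irrelevant : ∀ {X Y : Part} → Nullary.Irrelevant (X ≡ Y)
Part-irrelevant = Decidable⇒UIP.≡-irrelevant _≟P_

Block↔blockSize : ∀ {n} (part : Fin n → Part) X → Block part X ↔ Fin (blockSize part X)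
Block↔blockSize part X = Σ↔count (λ v → part v ≟P X) Part-irrelevant

-- The SI-core graph whose blocks P₁ and P₂ are disjoint unions of cliques of sizes a and b.
module Core (s : ℕ) (a b : List ℕ) where

  size : Part → ℕ
  size S₁ = s
  size S₂ = s
  size P₁ = sum a
  size P₂ = sum b

  label : (X : Part) → Fin (size X) → ℕ
  label S₁ _ = 0
  label S₂ _ = 0
  label P₁   = blockLabel a
  label P₂   = blockLabel b

  order : ℕ
  order = s + s + sum a + sum b

  vertices : Fin order ↔ Σ Part (Fin ∘ size)
  vertices = begin
    Fin order                                         ↔⟨ +↔⊎ ⟩
    (Fin (s + s + sum a) ⊎ Fin (sum b))               ↔⟨ +↔⊎ ⊎-↔ ↔-refl ⟩
    ((Fin (s + s) ⊎ Fin (sum a)) ⊎ Fin (sum b))       ↔⟨ (+↔⊎ ⊎-↔ ↔-refl) ⊎-↔ ↔-refl ⟩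
    (((Fin s ⊎ Fin s) ⊎ Fin (sum a)) ⊎ Fin (sum b))   ↔⟨ ⊎↔ΣPart (Fin ∘ size) ⟩
    Σ Part (Fin ∘ size)                               ∎
    where open EquationalReasoning

  part : Fin order → Part
  part = proj₁ ∘ to vertices

  comp : Fin order → ℕ
  comp = uncurry label ∘ to vertices

  graph : AGraph
  graph = order , labelGraph part comp

  Block↔size : ∀ X → Block part X ↔ Fin (size X)
  Block↔size = fibre-↔ vertices

  blockSize≡size : ∀ X → blockSize part X ≡ size X
  blockSize≡size X = Fin-↔⇒≡ (↔-trans (↔-sym (Block↔blockSize part X)) (Block↔size X))

  isSICore : ∀ {p} → sum a ≡ p → sum b ≡ p → SICore s p graph
  isSICore |a| |b| = labelGraph-SICore part comp (blockSize≡size S₁) (blockSize≡size S₂)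
                       (trans (blockSize≡size P₁) |a|) (trans (blockSize≡size P₂) |b|)

  label-Block↔size : ∀ {X} (z : Block part X) → label X (to (Block↔size X) z) ≡ comp (proj₁ z)
  label-Block↔size (u , refl) = refl

  blockKernel : ∀ X → KernelIso (comp ∘ proj₁ {B = λ u → part u ≡ X}) (label X)
  blockKernel X = record
    { bijection = Block↔size X
    ; preserves = λ z w → ≡⇔≡ (sym (label-Block↔size z)) (sym (label-Block↔size w)) }

module Decompose {s p n : ℕ} {G : Graph n} (d : SICore s p (n , G)) where
  open SICore d hiding (n; G)

  cliquePartition : ∀ X → Σ (List ℕ) λ λs → IsPartition (blockSize part X) λs × KernelIso (comp ∘ proj₁) (blockLabel λs)
  cliquePartition X = partitionType (comp ∘ proj₁) (Block↔blockSize part X)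

  λ₁ λ₂ : List ℕ
  λ₁ = proj₁ (cliquePartition P₁)
  λ₂ = proj₁ (cliquePartition P₂)

  λ₁-partition : IsPartition p λ₁
  λ₁-partition = subst (λ k → IsPartition k λ₁) sizeP₁ (proj₁ (proj₂ (cliquePartition P₁)))

  λ₂-partition : IsPartition p λ₂
  λ₂-partition = subst (λ k → IsPartition k λ₂) sizeP₂ (proj₁ (proj₂ (cliquePartition P₂)))

  module C = Core s λ₁ λ₂

  Block↔C : ∀ X → Block part X ↔ Fin (C.size X)
  Block↔C S₁ = subst (λ k → Block part S₁ ↔ Fin k) sizeS₁ (Block↔blockSize part S₁)
  Block↔C S₂ = subst (λ k → Block part S₂ ↔ Fin k) sizeS₂ (Block↔blockSize part S₂)
  Block↔C P₁ = bijection (proj₂ (proj₂ (cliquePartition P₁)))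
  Block↔C P₂ = bijection (proj₂ (proj₂ (cliquePartition P₂)))

  Block↔C-kernel : ∀ {X} → IsP X → ∀ (z w : Block part X) →
                   comp (proj₁ z) ≡ comp (proj₁ w) ⇔ C.label X (to (Block↔C X) z) ≡ C.label X (to (Block↔C X) w)
  Block↔C-kernel (inj₁ refl) = preserves (proj₂ (proj₂ (cliquePartition P₁)))
  Block↔C-kernel (inj₂ refl) = preserves (proj₂ (proj₂ (cliquePartition P₂)))

  φ : Fin n ↔ Fin C.order
  φ = ↔-trans (↔Σ-fibre part) (↔-trans (Σ-↔ ↔-refl (Block↔C _)) (↔-sym C.vertices))

  image : Fin n → Σ Part (Fin ∘ C.size)
  image u = part u , to (Block↔C (part u)) (u , refl)

  part-φ : ∀ u → C.part (to φ u) ≡ part u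
  part-φ u = cong proj₁ (strictlyInverseˡ C.vertices (image u))

  comp-φ : ∀ {X} (z : Block part X) → C.comp (to φ (proj₁ z)) ≡ C.label X (to (Block↔C X) z)
  comp-φ (u , refl) = cong (uncurry C.label) (strictlyInverseˡ C.vertices (image u))

  Iso-core : Iso (n , G) C.graph
  Iso-core = SICore-Iso d (C.isSICore (proj₂ (proj₂ λ₁-partition)) (proj₂ (proj₂ λ₂-partition)))
               id (λ _ _ _ _ → refl) φ part-φ
               (λ u v eq Pu → ⇔-trans (Block↔C-kernel Pu (u , refl) (v , sym eq))
                                       (≡⇔≡ (sym (comp-φ (u , refl))) (sym (comp-φ (v , sym eq)))))

swapPart : Part → Part
swapPart S₁ = S₂
swapPart S₂ = S₁
swapPart P₁ = P₂
swapPart P₂ = P₁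

swapPart-↔ : Part ↔ Part
swapPart-↔ = mk↔ₛ′ swapPart swapPart involutive involutive
  where
  involutive : ∀ X → swapPart (swapPart X) ≡ X
  involutive S₁ = refl
  involutive S₂ = refl
  involutive P₁ = refl
  involutive P₂ = refl

coreAdj-swapPart : ∀ X c Y d → coreAdj (swapPart X) c (swapPart Y) d ≡ coreAdj X c Y d
coreAdj-swapPart S₁ c S₁ d = refl
coreAdj-swapPart S₁ c S₂ d = refl
coreAdj-swapPart S₁ c P₁ d = refl
coreAdj-swapPart S₁ c P₂ d = refl
coreAdj-swapPart S₂ c S₁ d = refl
coreAdj-swapPart S₂ c S₂ d = refl
coreAdj-swapPart S₂ c P₁ d = refl
coreAdj-swapPart S₂ c P₂ d = refl
coreAdj-swapPart P₁ c S₁ d = refl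
coreAdj-swapPart P₁ c S₂ d = refl
coreAdj-swapPart P₁ c P₁ d = refl
coreAdj-swapPart P₁ c P₂ d = refl
coreAdj-swapPart P₂ c S₁ d = refl
coreAdj-swapPart P₂ c S₂ d = refl
coreAdj-swapPart P₂ c P₁ d = refl
coreAdj-swapPart P₂ c P₂ d = refl

module _ (s : ℕ) (a b : List ℕ) where
  private
    module C = Core s a b
    module C′ = Core s b a

    sizes : ∀ X → Fin (C.size X) ↔ Fin (C′.size (swapPart X))
    sizes S₁ = ↔-refl
    sizes S₂ = ↔-refl
    sizes P₁ = ↔-refl
    sizes P₂ = ↔-refl

    labels : ∀ X i → C′.label (swapPart X) (to (sizes X) i) ≡ C.label X i
    labels S₁ i = refl
    labels S₂ i = refl
    labels P₁ i = refl
    labels P₂ i = refl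

    f : Fin C.order ↔ Fin C′.order
    f = ↔-trans C.vertices (↔-trans (Σ-↔ swapPart-↔ (λ {X} → sizes X)) (↔-sym C′.vertices))

    image : Fin C.order → Σ Part (Fin ∘ C′.size)
    image u = swapPart (C.part u) , to (sizes (C.part u)) (proj₂ (to C.vertices u))

    comp-f : ∀ u → C′.comp (to f u) ≡ C.comp u
    comp-f u = trans (cong (uncurry C′.label) (strictlyInverseˡ C′.vertices (image u))) (labels (C.part u) _)

  Core-swap : ∀ {p} → sum a ≡ p → sum b ≡ p → Iso C.graph C′.graph
  Core-swap |a| |b| = SICore-Iso (C.isSICore |a| |b|) (C′.isSICore |b| |a|) swapPart coreAdj-swapPart f
    (λ u → cong proj₁ (strictlyInverseˡ C′.vertices (image u)))
    (λ u v _ _ → ≡⇔≡ (sym (comp-f u)) (sym (comp-f v)))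

-- Isomorphism invariants of SI-core graphs

Simplicial : ∀ {n} → Graph n → Fin n → Set
Simplicial G v = ∀ x y → adj G v x ≡ true → adj G v y ≡ true → x ≢ y → adj G x y ≡ true

CommonNeighbour : ∀ {n} → Graph n → Fin n → Fin n → Set
CommonNeighbour {n} G u w = Σ (Fin n) λ z → adj G u z ≡ true × adj G w z ≡ true

module SICoreInvariants {s p n : ℕ} {G : Graph n} (d : SICore s p (n , G)) (1≤s : 1 ≤ s) (1≤p : 1 ≤ p) where
  open SICore d hiding (n; G)

  inhabited : ∀ X {k} → blockSize part X ≡ k → 1 ≤ k → Block part X
  inhabited X refl 1≤k = from (Block↔blockSize part X) (fromℕ< 1≤k)

  S-vertex : ∀ {X} → IsS X → Block part X
  S-vertex (inj₁ refl) = inhabited S₁ sizeS₁ 1≤s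
  S-vertex (inj₂ refl) = inhabited S₂ sizeS₂ 1≤s

  P-vertex : ∀ {X} → IsP X → Block part X
  P-vertex (inj₁ refl) = inhabited P₁ sizeP₁ 1≤p
  P-vertex (inj₂ refl) = inhabited P₂ sizeP₂ 1≤p

  neighbour-of-P : ∀ {u v} → IsP (part u) → adj G u v ≡ true →
                   part v ≡ ownS (part u) ⊎ (part v ≡ part u × comp u ≡ comp v)
  neighbour-of-P {u} {v} Pu uv = coreAdj-P-true (comp u) (part v) (comp v) Pu (trans (sym (adj≡coreAdj d u v u≢v)) uv)
    where
    u≢v : u ≢ v
    u≢v refl = case trans (sym uv) (irrefl G u) of λ ()

  ownS-of-neighbour : ∀ {u z} → IsP (part u) → adj G u z ≡ true → ownS (part z) ≡ ownS (part u)
  ownS-of-neighbour {u} Pu uz with neighbour-of-P Pu uz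
  ... | inj₁ ez       = trans (cong ownS ez) (ownS-idem (part u))
  ... | inj₂ (ez , _) = cong ownS ez

  P⇒Simplicial : ∀ {v} → IsP (part v) → Simplicial G v
  P⇒Simplicial {v} Pv x y vx vy x≢y with neighbour-of-P Pv vx | neighbour-of-P Pv vy
  ... | inj₁ ex        | inj₁ ey        = clique x y x≢y (subst IsS (sym ex) (IsS-ownS Pv)) (subst IsS (sym ey) (IsS-ownS Pv))
  ... | inj₁ ex        | inj₂ (ey , _)  = trans (symm G x y) (toOwnS y x (subst IsP (sym ey) Pv) (trans ex (cong ownS (sym ey))))
  ... | inj₂ (ex , _)  | inj₁ ey        = toOwnS x y (subst IsP (sym ex) Pv) (trans ey (cong ownS (sym ex)))
  ... | inj₂ (ex , cx) | inj₂ (ey , cy) =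
    Equivalence.from (cluster x y x≢y (subst IsP (sym ex) Pv) (trans ey (sym ex))) (trans (sym cx) cy)

  -- v sees a vertex x of Q and a vertex y of the other S-block, and x, y are not adjacent.
  ownS⇒¬Simplicial : ∀ {v Q} → IsP Q → part v ≡ ownS Q → ¬ Simplicial G v
  ownS⇒¬Simplicial {v} {Q} PQ ev simplicial = case trans (sym (simplicial x y vx vy x≢y)) xy of λ ()
    where
    x = proj₁ (P-vertex PQ)
    ex = proj₂ (P-vertex PQ)
    y = proj₁ (S-vertex (IsS-otherS PQ))
    ey = proj₂ (S-vertex (IsS-otherS PQ))
    Px : IsP (part x)
    Px = subst IsP (sym ex) PQ
    vx : adj G v x ≡ true
    vx = trans (symm G v x) (toOwnS x v Px (trans ev (cong ownS (sym ex))))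
    vy : adj G v y ≡ true
    vy = clique v y (λ v≡y → ownS≢otherS PQ (trans (sym ev) (trans (cong part v≡y) ey)))
                (subst IsS (sym ev) (IsS-ownS PQ)) (subst IsS (sym ey) (IsS-otherS PQ))
    x≢y : x ≢ y
    x≢y x≡y = IsP⇒≢otherS PQ (trans (sym ex) (trans (cong part x≡y) ey))
    xy : adj G x y ≡ false
    xy = noOtherS x y Px (trans ey (cong otherS (sym ex)))

  IsP⇔Simplicial : ∀ v → IsP (part v) ⇔ Simplicial G v
  IsP⇔Simplicial v = mk⇔ P⇒Simplicial λ simplicial →
    [ (λ Sv → contradiction simplicial (S⇒¬Simplicial Sv)) , id ]′ (IsS⊎IsP (part v))
    where
    S⇒¬Simplicial : IsS (part v) → ¬ Simplicial G v
    S⇒¬Simplicial (inj₁ ev) = ownS⇒¬Simplicial (inj₁ refl) ev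
    S⇒¬Simplicial (inj₂ ev) = ownS⇒¬Simplicial (inj₂ refl) ev

  sameBlock⇔CommonNeighbour : ∀ {u w} → IsP (part u) → IsP (part w) → part u ≡ part w ⇔ CommonNeighbour G u w
  sameBlock⇔CommonNeighbour {u} {w} Pu Pw = mk⇔ common same
    where
    common : part u ≡ part w → CommonNeighbour G u w
    common eq = z , toOwnS u z Pu ez , toOwnS w z Pw (trans ez (cong ownS eq))
      where
      z = proj₁ (S-vertex (IsS-ownS Pu))
      ez = proj₂ (S-vertex (IsS-ownS Pu))
    same : CommonNeighbour G u w → part u ≡ part w
    same (z , uz , wz) = ownS-injective Pu Pw (trans (sym (ownS-of-neighbour Pu uz)) (ownS-of-neighbour Pw wz))

  sameComp⇔adjacent : ∀ {u w} → IsP (part u) → part u ≡ part w → comp u ≡ comp w ⇔ (u ≡ w ⊎ adj G u w ≡ true)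
  sameComp⇔adjacent {u} {w} Pu eq with u ≟F w
  ... | yes refl = mk⇔ (λ _ → inj₁ refl) (λ _ → refl)
  ... | no u≢w   = mk⇔ (inj₂ ∘ Equivalence.from adjacent⇔)
                        [ (λ u≡w → contradiction u≡w u≢w) , Equivalence.to adjacent⇔ ]′
    where
    adjacent⇔ : adj G u w ≡ true ⇔ comp u ≡ comp w
    adjacent⇔ = cluster u w u≢w Pu (sym eq)

module _ {n m} {G : Graph n} {H : Graph m} (iso : Iso (n , G) (m , H)) where
  private
    f = proj₁ iso
    adj-f = proj₂ iso

  Simplicial-Iso : ∀ {v} → Simplicial G v → Simplicial H (to f v)
  Simplicial-Iso {v} simplicial x′ y′ vx′ vy′ x′≢y′ = begin
    adj H x′ y′                                  ≡⟨ cong₂ (adj H) (strictlyInverseˡ f x′) (strictlyInverseˡ f y′) ⟨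
    adj H (to f (from f x′)) (to f (from f y′))  ≡⟨ adj-f (from f x′) (from f y′) ⟨
    adj G (from f x′) (from f y′)                ≡⟨ simplicial (from f x′) (from f y′) (adj-from vx′) (adj-from vy′)
                                                      (x′≢y′ ∘ to-injective (↔-sym f)) ⟩
    true                                         ∎
    where
    open ≡-Reasoning
    adj-from : ∀ {z′} → adj H (to f v) z′ ≡ true → adj G v (from f z′) ≡ true
    adj-from {z′} vz′ = trans (adj-f v (from f z′)) (trans (cong (adj H (to f v)) (strictlyInverseˡ f z′)) vz′)

  CommonNeighbour-Iso : ∀ {u w} → CommonNeighbour G u w → CommonNeighbour H (to f u) (to f w)
  CommonNeighbour-Iso {u} {w} (z , uz , wz) = to f z , trans (sym (adj-f u z)) uz , trans (sym (adj-f w z)) wz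

  equalOrAdjacent-Iso : ∀ {u w} → (u ≡ w ⊎ adj G u w ≡ true) ⇔ (to f u ≡ to f w ⊎ adj H (to f u) (to f w) ≡ true)
  equalOrAdjacent-Iso {u} {w} = mk⇔ [ inj₁ ∘ cong (to f) , inj₂ ∘ trans (sym (adj-f u w)) ]′
                                    [ inj₁ ∘ to-injective f , inj₂ ∘ trans (adj-f u w) ]′

module _ {n m} {G : Graph n} {H : Graph m} (iso : Iso (n , G) (m , H)) where
  private
    f = proj₁ iso

  Simplicial⇔ : ∀ v → Simplicial G v ⇔ Simplicial H (to f v)
  Simplicial⇔ v = mk⇔ (Simplicial-Iso {G = G} {H} iso)
    (λ simplicial → subst (Simplicial G) (strictlyInverseʳ f v)
                          (Simplicial-Iso {G = H} {G} (Iso-sym {n , G} {m , H} iso) simplicial))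

  CommonNeighbour⇔ : ∀ u w → CommonNeighbour G u w ⇔ CommonNeighbour H (to f u) (to f w)
  CommonNeighbour⇔ u w = mk⇔ (CommonNeighbour-Iso {G = G} {H} iso)
    (λ common → subst₂ (CommonNeighbour G) (strictlyInverseʳ f u) (strictlyInverseʳ f w)
                       (CommonNeighbour-Iso {G = H} {G} (Iso-sym {n , G} {m , H} iso) common))

module IsoBlocks {s p n m : ℕ} {G : Graph n} {H : Graph m} (dG : SICore s p (n , G)) (dH : SICore s p (m , H))
                 (1≤s : 1 ≤ s) (1≤p : 1 ≤ p) (iso : Iso (n , G) (m , H)) where
  private
    module G = SICore dG
    module H = SICore dH
    module IG = SICoreInvariants dG 1≤s 1≤p
    module IH = SICoreInvariants dH 1≤s 1≤p
    f = proj₁ iso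

  IsP-Iso : ∀ u → IsP (G.part u) ⇔ IsP (H.part (to f u))
  IsP-Iso u = ⇔-trans (IG.IsP⇔Simplicial u) (⇔-trans (Simplicial⇔ {G = G} {H} iso u) (⇔-sym (IH.IsP⇔Simplicial (to f u))))

  sameBlock-Iso : ∀ {u w} → IsP (G.part u) → IsP (G.part w) → G.part u ≡ G.part w ⇔ H.part (to f u) ≡ H.part (to f w)
  sameBlock-Iso {u} {w} Pu Pw =
    ⇔-trans (IG.sameBlock⇔CommonNeighbour Pu Pw)
      (⇔-trans (CommonNeighbour⇔ {G = G} {H} iso u w)
        (⇔-sym (IH.sameBlock⇔CommonNeighbour (Equivalence.to (IsP-Iso u) Pu) (Equivalence.to (IsP-Iso w) Pw))))

  inBlock-Iso : ∀ {v} → IsP (G.part v) → ∀ u → G.part u ≡ G.part v ⇔ H.part (to f u) ≡ H.part (to f v)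
  inBlock-Iso {v} Pv u = mk⇔
    (λ eq → Equivalence.to (sameBlock-Iso (subst IsP (sym eq) Pv) Pv) eq)
    (λ eq → Equivalence.from (sameBlock-Iso (Equivalence.from (IsP-Iso u) (subst IsP (sym eq) (Equivalence.to (IsP-Iso v) Pv))) Pv) eq)

  Block-KernelIso : ∀ {v X Y} → G.part v ≡ X → H.part (to f v) ≡ Y → IsP X →
                    KernelIso (G.comp ∘ proj₁ {B = λ u → G.part u ≡ X}) (H.comp ∘ proj₁ {B = λ u → H.part u ≡ Y})
  Block-KernelIso {v} refl refl Pv = record
    { bijection = Σ-↔ f (λ {u} → ⇔⇒↔ Part-irrelevant Part-irrelevant (inBlock-Iso Pv u))
    ; preserves = λ (u , eu) (w , ew) →
        ⇔-trans (IG.sameComp⇔adjacent (subst IsP (sym eu) Pv) (trans eu (sym ew)))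
          (⇔-trans (equalOrAdjacent-Iso {G = G} {H} iso)
            (⇔-sym (IH.sameComp⇔adjacent (subst IsP (sym (image eu)) PH) (trans (image eu) (sym (image ew)))))) }
    where
    PH : IsP (H.part (to f v))
    PH = Equivalence.to (IsP-Iso v) Pv
    image : ∀ {u} → G.part u ≡ G.part v → H.part (to f u) ≡ H.part (to f v)
    image {u} = Equivalence.to (inBlock-Iso Pv u)

UnorderedEq : ∀ {A : Set} → A × A → A × A → Set
UnorderedEq (a , b) (c , d) = (a ≡ c × b ≡ d) ⊎ (a ≡ d × b ≡ c)

-- An isomorphism maps P-blocks onto P-blocks and preserves their clique partitions.
Core-Iso⇒UnorderedEq : ∀ {s p a b c d} → 1 ≤ s → 1 ≤ p →
                       IsPartition p a → IsPartition p b → IsPartition p c → IsPartition p d →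
                       Iso (Core.graph s a b) (Core.graph s c d) → UnorderedEq (a , b) (c , d)
Core-Iso⇒UnorderedEq {s} {p} {a} {b} {c} {d} 1≤s 1≤p a-part b-part c-part d-part iso =
  match (Equivalence.to (IsP-Iso v₁) (subst IsP (sym e₁) (inj₁ refl)))
        (Equivalence.to (IsP-Iso v₂) (subst IsP (sym e₂) (inj₂ refl)))
  where
  module G = Core s a b
  module H = Core s c d
  dG = G.isSICore (proj₂ (proj₂ a-part)) (proj₂ (proj₂ b-part))
  dH = H.isSICore (proj₂ (proj₂ c-part)) (proj₂ (proj₂ d-part))
  open IsoBlocks dG dH 1≤s 1≤p iso
  module IG = SICoreInvariants dG 1≤s 1≤p
  f = proj₁ iso
  v₁ = proj₁ (IG.P-vertex (inj₁ refl))
  e₁ = proj₂ (IG.P-vertex (inj₁ refl))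
  v₂ = proj₁ (IG.P-vertex (inj₂ refl))
  e₂ = proj₂ (IG.P-vertex (inj₂ refl))
  labels : ∀ {v X Y} → G.part v ≡ X → H.part (to f v) ≡ Y → IsP X → KernelIso (G.label X) (H.label Y)
  labels {X = X} {Y} eX eY PX =
    KernelIso-trans (KernelIso-sym (G.blockKernel X)) (KernelIso-trans (Block-KernelIso eX eY PX) (H.blockKernel Y))
  distinct : H.part (to f v₁) ≢ H.part (to f v₂)
  distinct eq = case trans (sym e₁) (trans (Equivalence.from (sameBlock-Iso P₁′ P₂′) eq) e₂) of λ ()
    where
    P₁′ = subst IsP (sym e₁) (inj₁ refl)
    P₂′ = subst IsP (sym e₂) (inj₂ refl)
  match : IsP (H.part (to f v₁)) → IsP (H.part (to f v₂)) → UnorderedEq (a , b) (c , d)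
  match (inj₁ y₁) (inj₂ y₂) = inj₁ (partition-unique a-part c-part (labels e₁ y₁ (inj₁ refl)) ,
                                     partition-unique b-part d-part (labels e₂ y₂ (inj₂ refl)))
  match (inj₂ y₁) (inj₁ y₂) = inj₂ (partition-unique a-part d-part (labels e₁ y₁ (inj₁ refl)) ,
                                     partition-unique b-part c-part (labels e₂ y₂ (inj₂ refl)))
  match (inj₁ y₁) (inj₁ y₂) = contradiction (trans y₁ (sym y₂)) distinct
  match (inj₂ y₁) (inj₂ y₂) = contradiction (trans y₁ (sym y₂)) distinct

-- Unordered pairs

unorderedPairs : ∀ {A : Set} → List A → List (A × A)
unorderedPairs []       = []
unorderedPairs (x ∷ xs) = map (x ,_) (x ∷ xs) ++ unorderedPairs xs

module _ {A : Set} where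

  unorderedPairs-All : ∀ {P : A → Set} {xs} → All P xs → All (λ (a , b) → P a × P b) (unorderedPairs xs)
  unorderedPairs-All []           = []
  unorderedPairs-All (px ∷ pxs) = All.++⁺ (All.map⁺ (All.map (px ,_) (px ∷ pxs))) (unorderedPairs-All pxs)

  unorderedPairs-complete : ∀ {x y : A} {xs} → x ∈ xs → y ∈ xs →
                            (x , y) ∈ unorderedPairs xs ⊎ (y , x) ∈ unorderedPairs xs
  unorderedPairs-complete {xs = z ∷ zs} (here refl) y∈ = inj₁ (∈-++⁺ˡ (∈-map⁺ (z ,_) y∈))
  unorderedPairs-complete {xs = z ∷ zs} (there x∈) (here refl) = inj₂ (∈-++⁺ˡ (∈-map⁺ (z ,_) (there x∈)))
  unorderedPairs-complete {xs = z ∷ zs} (there x∈) (there y∈) =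
    Data.Sum.map (∈-++⁺ʳ (map (z ,_) (z ∷ zs))) (∈-++⁺ʳ (map (z ,_) (z ∷ zs))) (unorderedPairs-complete x∈ y∈)

  unorderedPairs-distinct : ∀ {xs : List A} → Unique xs → AllPairs (λ u v → ¬ UnorderedEq u v) (unorderedPairs xs)
  unorderedPairs-distinct []                 = []
  unorderedPairs-distinct {x ∷ xs} (x∉xs ∷ xs!) =
    AllPairs.++⁺ (AllPairs.map⁺ (AllPairs.map same-head (x∉xs ∷ xs!))) (unorderedPairs-distinct xs!)
                 (All.map⁺ (All.universal (λ _ → All.map other-head (unorderedPairs-All x∉xs)) (x ∷ xs)))
    where
    same-head : ∀ {y z} → y ≢ z → ¬ UnorderedEq (x , y) (x , z)
    same-head y≢z (inj₁ (_ , y≡z))     = y≢z y≡z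
    same-head y≢z (inj₂ (x≡z , y≡x)) = y≢z (trans y≡x x≡z)
    other-head : ∀ {y c d} → x ≢ c × x ≢ d → ¬ UnorderedEq (x , y) (c , d)
    other-head (x≢c , _) (inj₁ (x≡c , _)) = x≢c x≡c
    other-head (_ , x≢d) (inj₂ (x≡d , _)) = x≢d x≡d

  length-unorderedPairs : ∀ (xs : List A) → length (unorderedPairs xs) ≡ length xs * (length xs + 1) / 2
  length-unorderedPairs xs = trans (sym (m*n/n≡m (length (unorderedPairs xs)) 2)) (cong (_/ 2) (doubled xs))
    where
    step : ∀ n → suc n * 2 + n * (n + 1) ≡ suc n * (suc n + 1)
    step = solve-∀
    doubled : ∀ (xs : List A) → length (unorderedPairs xs) * 2 ≡ length xs * (length xs + 1)
    doubled []       = refl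
    doubled (x ∷ xs) = begin
      length (map (x ,_) (x ∷ xs) ++ unorderedPairs xs) * 2  ≡⟨ cong (_* 2) (length-++ (map (x ,_) (x ∷ xs))) ⟩
      (length (map (x ,_) (x ∷ xs)) + P) * 2                 ≡⟨ cong (λ k → (k + P) * 2) (length-map (x ,_) (x ∷ xs)) ⟩
      (suc n + P) * 2                                        ≡⟨ *-distribʳ-+ 2 (suc n) P ⟩
      suc n * 2 + P * 2                                      ≡⟨ cong (suc n * 2 +_) (doubled xs) ⟩
      suc n * 2 + n * (n + 1)                                ≡⟨ step n ⟩
      suc n * (suc n + 1)                                    ∎
      where
      open ≡-Reasoning
      n = length xs
      P = length (unorderedPairs xs)

All⇒AllPairs : ∀ {A : Set} {P : A → Set} {xs} → All P xs → AllPairs (λ x y → P x × P y) xs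
All⇒AllPairs []         = []
All⇒AllPairs (px ∷ pxs) = All.map (px ,_) pxs ∷ All⇒AllPairs pxs

SICore⇒Any-Iso : ∀ {s p} {parts : List (List ℕ)} → (∀ {λs} → IsPartition p λs → λs ∈ parts) →
                 ∀ {G} → SICore s p G → Any (Iso G) (map (uncurry (Core.graph s)) (unorderedPairs parts))
SICore⇒Any-Iso {s} {parts = parts} listed {n , G} d =
  [ found Iso-core , found Iso-swapped ]′ (unorderedPairs-complete (listed λ₁-partition) (listed λ₂-partition))
  where
  open Decompose d
  Iso-swapped : Iso (n , G) (Core.graph s λ₂ λ₁)
  Iso-swapped = Iso-trans {n , G} {Core.graph s λ₁ λ₂} {Core.graph s λ₂ λ₁} Iso-core
                  (Core-swap s λ₁ λ₂ (proj₂ (proj₂ λ₁-partition)) (proj₂ (proj₂ λ₂-partition)))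
  found : ∀ {ab} → Iso (n , G) (uncurry (Core.graph s) ab) → ab ∈ unorderedPairs parts →
          Any (Iso (n , G)) (map (uncurry (Core.graph s)) (unorderedPairs parts))
  found iso ab∈ = Any.map⁺ (lose ab∈ iso)

theorem8 : (s p : ℕ) → 2 ≤ s → 2 ≤ p →
    (parts : List (List ℕ)) → Unique parts → (∀ λs → IsPartition p λs ⇔ λs ∈ parts) →
    Σ (List AGraph) λ L →
    All (SICore s p) L ×
    AllPairs (λ G H → ¬ Iso G H) L ×
    (∀ G → SICore s p G → Any (Iso G) L) ×
    length L ≡ length parts * (length parts + 1) / 2
theorem8 s p 2≤s 2≤p parts parts-unique parts-complete = L , all-SICore , pairwise-nonIso , complete , length-L
  where
  L : List AGraph
  L = map (uncurry (Core.graph s)) (unorderedPairs parts)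
  pair-partitions : All (λ (a , b) → IsPartition p a × IsPartition p b) (unorderedPairs parts)
  pair-partitions = unorderedPairs-All (All.tabulate (Equivalence.from (parts-complete _)))
  all-SICore : All (SICore s p) L
  all-SICore = All.map⁺ (All.map (λ (pa , pb) → Core.isSICore s _ _ (proj₂ (proj₂ pa)) (proj₂ (proj₂ pb))) pair-partitions)
  pairwise-nonIso : AllPairs (λ G H → ¬ Iso G H) L
  pairwise-nonIso = AllPairs.map⁺ (AllPairs.zipWith
    (λ (((pa , pb) , (pc , pd)) , distinct) → distinct ∘ Core-Iso⇒UnorderedEq (<⇒≤ 2≤s) (<⇒≤ 2≤p) pa pb pc pd)
    (All⇒AllPairs pair-partitions , unorderedPairs-distinct parts-unique))
  complete : ∀ G → SICore s p G → Any (Iso G) L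
  complete _ = SICore⇒Any-Iso (Equivalence.to (parts-complete _))
  length-L : length L ≡ length parts * (length parts + 1) / 2
  length-L = trans (length-map (uncurry (Core.graph s)) (unorderedPairs parts)) (length-unorderedPairs parts)
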